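{- For every $n\ge 2$, $\chi'_<(D_n)>2^{n-2}$.
   Context: Edge-ordered graph: finite simple graph with a linear order on its edges; isomorphisms preserve order; subgraphs carry the induced order. A simple graph can avoid $H$ if some edge-ordering of it has no subgraph isomorphic to $H$. The order chromatic number $\chi'_<(H)$ is the least chromatic number of a finite simple graph that cannot avoid $H$ ($\infty$ if none). For $n\ge2$, $D_n$ is the edge-ordered graph on vertices $x_1,\dots,x_n$ whose edges are the $2n-3$ pairs incident to $x_1$ or $x_n$, ordered as $x_1x_2<x_1x_3<\cdots<x_1x_n<x_2x_n<\cdots<x_{n-1}x_n$. -}

module Defs where

open import Data.Nat using (ℕ; zero; suc; _+_; _∸_; _<_; _≡ᵇ_)
open import Data.Fin using (Fin; toℕ)
open import Data.Bool using (Bool; true; false; not; _∧_; _∨_; if_then_else_)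
open import Data.Bool.Properties using (∨-comm)
open import Data.Product using (Σ; _×_; _,_)
open import Data.Sum using (_⊎_)
open import Relation.Nullary using (¬_)
open import Relation.Binary.PropositionalEquality using (_≡_; _≢_; refl; cong; cong₂)
open import Function.Definitions using (Injective)

record Graph : Set where
  field
    V     : ℕ
    adj   : Fin V → Fin V → Bool
    sym   : ∀ u v → adj u v ≡ adj v u
    irr   : ∀ v → adj v v ≡ false

open Graph public

Edge : (G : Graph) → Fin (V G) → Fin (V G) → Set
Edge G u v = adj G u v ≡ true

SamePair : {A : Set} → A → A → A → A → Set
SamePair a b c d = (a ≡ c × b ≡ d) ⊎ (a ≡ d × b ≡ c)

-- An edge-ordering of G: a linear order on E(G), represented by an
-- injective ranking of the (unordered) edges into ℕ.  Edge e comes before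
-- edge e' iff rank e < rank e'.  Values of rank on non-edges are irrelevant.

record EdgeOrdering (G : Graph) : Set where
  field
    rank     : Fin (V G) → Fin (V G) → ℕ
    rank-sym : ∀ u v → rank u v ≡ rank v u
    rank-inj : ∀ a b c d → Edge G a b → Edge G c d →
               rank a b ≡ rank c d → SamePair a b c d

open EdgeOrdering public

-- The edge-ordered graph H (given by graph H and its edge ranking rH) is
-- contained in the edge-ordered graph (G , o): there is an injective
-- vertex map sending edges of H to edges of G and preserving the
-- edge order (i.e. the subgraph formed by the image edges, with the
-- order induced from G, is isomorphic to H as an edge-ordered graph).

Contains : (H : Graph) (rH : Fin (V H) → Fin (V H) → ℕ)
           (G : Graph) (o : EdgeOrdering G) → Set
Contains H rH G o =
  Σ (Fin (V H) → Fin (V G)) λ φ →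
    Injective _≡_ _≡_ φ ×
    (∀ u v → Edge H u v → Edge G (φ u) (φ v)) ×
    (∀ a b c d → Edge H a b → Edge H c d → rH a b < rH c d →
       rank o (φ a) (φ b) < rank o (φ c) (φ d))

CanAvoid : (G : Graph) (H : Graph) (rH : Fin (V H) → Fin (V H) → ℕ) → Set
CanAvoid G H rH = Σ (EdgeOrdering G) λ o → ¬ Contains H rH G o

Colorable : Graph → ℕ → Set
Colorable G k = Σ (Fin (V G) → Fin k) λ c → ∀ u v → Edge G u v → c u ≢ c v

-- χ'_<(H) > k  ⇔  every finite simple graph with χ(G) ≤ k can avoid H
-- (unfolding: the least χ of a graph that cannot avoid H exceeds k,
-- including the case that no such graph exists, χ'_< = ∞).
OrderChromaticGreaterThan : (H : Graph) (rH : Fin (V H) → Fin (V H) → ℕ) → ℕ → Set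
OrderChromaticGreaterThan H rH k = (G : Graph) → Colorable G k → CanAvoid G H rH

-- D_n.  Vertex x_{i+1} is (i : Fin n); x_1 = index 0, x_n = index n ∸ 1.

≡ᵇ-sym : ∀ m n → (m ≡ᵇ n) ≡ (n ≡ᵇ m)
≡ᵇ-sym zero zero = refl
≡ᵇ-sym zero (suc n) = refl
≡ᵇ-sym (suc m) zero = refl
≡ᵇ-sym (suc m) (suc n) = ≡ᵇ-sym m n

≡ᵇ-refl : ∀ m → (m ≡ᵇ m) ≡ true
≡ᵇ-refl zero = refl
≡ᵇ-refl (suc m) = ≡ᵇ-refl m

isEnd : (n : ℕ) → Fin n → Bool
isEnd n i = (toℕ i ≡ᵇ 0) ∨ (toℕ i ≡ᵇ (n ∸ 1))

adjD : (n : ℕ) → Fin n → Fin n → Bool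
adjD n i j = not (toℕ i ≡ᵇ toℕ j) ∧ (isEnd n i ∨ isEnd n j)

adjD-sym : ∀ n i j → adjD n i j ≡ adjD n j i
adjD-sym n i j = cong₂ _∧_ (cong not (≡ᵇ-sym (toℕ i) (toℕ j)))
                           (∨-comm (isEnd n i) (isEnd n j))

adjD-irr : ∀ n i → adjD n i i ≡ false
adjD-irr n i with toℕ i ≡ᵇ toℕ i | ≡ᵇ-refl (toℕ i)
... | .true | refl = refl

D : ℕ → Graph
D n = record { V = n ; adj = adjD n ; sym = adjD-sym n ; irr = adjD-irr n }

-- Edge order of D_n:  x_1x_j ↦ j-1  (2 ≤ j ≤ n),  x_ix_n ↦ n-1 + (i-1)
-- (2 ≤ i ≤ n-1), giving x_1x_2 < … < x_1x_n < x_2x_n < … < x_{n-1}x_n.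
-- (Symmetric on edges; values on non-edges are irrelevant.)
rankD : (n : ℕ) → Fin n → Fin n → ℕ
rankD n i j =
  if toℕ i ≡ᵇ 0 then toℕ j
  else if toℕ j ≡ᵇ 0 then toℕ i
  else if toℕ j ≡ᵇ (n ∸ 1) then (n ∸ 1) + toℕ i
  else (n ∸ 1) + toℕ j

-- Colour G properly with 0, …, 2 ^ k − 1 and call the level of an edge the position of the
-- highest binary digit in which the colours of its ends differ.  Order the edges by decreasing
-- level, then by increasing difference of colours, breaking the remaining ties by vertex
-- indices.  In a copy of D_{k+2} with x₁ ↦ a, xₙ ↦ b and middle vertices y₁, …, y_k, the
-- pattern a yᵢ < a b < yᵢ b forces level(a yᵢ) = level(a b) > level(yᵢ b), since three colours
-- cannot pairwise first differ in the same digit, and puts the colour of yᵢ strictly between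
-- those of a and b.  Then a yᵢ < a yᵢ₊₁ and yᵢ b < yᵢ₊₁ b force level(yᵢ₊₁ b) < level(yᵢ b):
-- with equal levels the colour differences make yᵢ at most as far as yᵢ₊₁ from both a and b,
-- so yᵢ and yᵢ₊₁ have the same colour, and the tie-break orders the two pairs of edges
-- oppositely.  So level(a b) > level(y₁ b) > … > level(y_k b) > 0 gives k + 1 ≤ level(a b) ≤ k.

module Submission where

open import Defs
open import Data.Nat using (ℕ; _≤_; _^_; _∸_)
open import Data.Nat.Base using (zero; suc; _+_; _*_; _<_; _≡ᵇ_; ∣_-_∣; _≤′_; ≤′-refl; ≤′-step; z≤n; s≤s)
open import Data.Nat.Properties
open import Data.Nat.DivMod using (_/_; _%_; _mod_; m≡m%n+[m/n]*n; m%n<n; /-monoˡ-≤; m<n*o⇒m/o<n; m<n⇒m%n≡m)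
open import Data.Bool using (true; false)
open import Data.Unit using (tt)
open import Data.Fin using (Fin; toℕ)
open import Data.Fin.Properties using (toℕ<n; toℕ-injective; toℕ-fromℕ<)
open import Data.Product using (_×_; _,_; proj₁; proj₂)
open import Data.Sum using (_⊎_; inj₁; inj₂)
open import Data.Vec using (Vec; []; _∷_)
open import Data.Vec.Properties using (∷-injectiveˡ; ∷-injectiveʳ)
open import Data.Vec.Relation.Unary.All using (All; []; _∷_)
open import Data.Vec.Relation.Binary.Lex.Strict using (Lex-<; base; this; next)
open import Data.Empty using (⊥; ⊥-elim)
open import Function using (_∘_)
open import Relation.Nullary using (¬_; yes; no)
open import Relation.Binary using (tri<; tri≈; tri>)
open import Relation.Binary.PropositionalEquality
  using (_≡_; _≢_; refl; trans; cong; cong₂; subst; subst₂; module ≡-Reasoning)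
import Relation.Binary.PropositionalEquality as ≡

-- Base-B numerals and lexicographic order

pair-< : ∀ {A B x y} → x < A → y < B → x * B + y < A * B
pair-< {A} {B} {x} {y} x<A y<B = begin-strict
  x * B + y  <⟨ +-monoʳ-< (x * B) y<B ⟩
  x * B + B  ≡⟨ +-comm (x * B) B ⟩
  suc x * B  ≤⟨ *-monoˡ-≤ B x<A ⟩
  A * B      ∎
  where open ≤-Reasoning

pair-<⇒lex : ∀ {B x x′ y y′} → y < B → y′ < B →
             x * B + y < x′ * B + y′ → x < x′ ⊎ (x ≡ x′ × y < y′)
pair-<⇒lex {B} {x} {x′} {y} {y′} _ y′<B lt with <-cmp x x′
... | tri< x<x′ _ _ = inj₁ x<x′
... | tri≈ _ refl _ = inj₂ (refl , +-cancelˡ-< (x * B) y y′ lt)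
... | tri> _ _ x′<x = ⊥-elim (<-asym lt (<-≤-trans (pair-< x′<x y′<B) (m≤m+n (x * B) y)))

pair-injective : ∀ {B x x′ y y′} → y < B → y′ < B →
                 x * B + y ≡ x′ * B + y′ → x ≡ x′ × y ≡ y′
pair-injective {B} {x} {x′} {y} {y′} y<B y′<B eq with <-cmp x x′
... | tri< x<x′ _ _ = ⊥-elim (<-irrefl eq (<-≤-trans (pair-< x<x′ y<B) (m≤m+n (x′ * B) y′)))
... | tri≈ _ refl _ = refl , +-cancelˡ-≡ (x * B) y y′ eq
... | tri> _ _ x′<x = ⊥-elim (<-irrefl (≡.sym eq) (<-≤-trans (pair-< x′<x y′<B) (m≤m+n (x * B) y)))

numeral : ∀ {m} → ℕ → Vec ℕ m → ℕ
numeral B [] = 0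
numeral {suc m} B (d ∷ ds) = d * B ^ m + numeral B ds

numeral-< : ∀ {B m} {ds : Vec ℕ m} → All (_< B) ds → numeral B ds < B ^ m
numeral-< [] = s≤s z≤n
numeral-< (d<B ∷ ds<B) = pair-< d<B (numeral-< ds<B)

numeral-<⇒lex : ∀ {B m} {ds es : Vec ℕ m} → All (_< B) ds → All (_< B) es →
                numeral B ds < numeral B es → Lex-< _≡_ _<_ ds es
numeral-<⇒lex [] [] ()
numeral-<⇒lex (_ ∷ ds<B) (_ ∷ es<B) lt with pair-<⇒lex (numeral-< ds<B) (numeral-< es<B) lt
... | inj₁ d<e = this d<e refl
... | inj₂ (d≡e , lt′) = next d≡e (numeral-<⇒lex ds<B es<B lt′)

numeral-injective : ∀ {B m} {ds es : Vec ℕ m} → All (_< B) ds → All (_< B) es →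
                    numeral B ds ≡ numeral B es → ds ≡ es
numeral-injective [] [] _ = refl
numeral-injective (_ ∷ ds<B) (_ ∷ es<B) eq with pair-injective (numeral-< ds<B) (numeral-< es<B) eq
... | d≡e , eq′ = cong₂ _∷_ d≡e (numeral-injective ds<B es<B eq′)

lex-head-≤ : ∀ {m x y} {xs ys : Vec ℕ m} → Lex-< _≡_ _<_ (x ∷ xs) (y ∷ ys) → x ≤ y
lex-head-≤ (this x<y _) = <⇒≤ x<y
lex-head-≤ (next refl _) = ≤-refl

lex-tail : ∀ {m x y} {xs ys : Vec ℕ m} → x ≡ y → Lex-< _≡_ _<_ (x ∷ xs) (y ∷ ys) → Lex-< _≡_ _<_ xs ys
lex-tail refl (this x<x _) = ⊥-elim (<-irrefl refl x<x)
lex-tail _ (next _ xs<ys) = xs<ys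

LexDesc : ℕ × ℕ → ℕ × ℕ → Set
LexDesc p q = proj₁ p < proj₁ q ⊎ (proj₁ p ≡ proj₁ q × proj₂ q < proj₂ p)

lex-desc : ∀ {n i i′ j j′} → Lex-< _≡_ _<_ (i ∷ n ∸ j ∷ []) (i′ ∷ n ∸ j′ ∷ []) →
           LexDesc (i , j) (i′ , j′)
lex-desc (this i<i′ _) = inj₁ i<i′
lex-desc (next i≡i′ (this lt _)) = inj₂ (i≡i′ , ∸-cancelʳ-< lt)
lex-desc (next _ (next _ (base ())))

LexDesc-fst≡ : ∀ {p q} → proj₁ p ≡ proj₁ q → LexDesc p q → proj₂ q < proj₂ p
LexDesc-fst≡ refl (inj₁ lt) = ⊥-elim (<-irrefl refl lt)
LexDesc-fst≡ _ (inj₂ (_ , lt)) = lt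

LexDesc-snd≡ : ∀ {p q} → proj₂ p ≡ proj₂ q → LexDesc p q → proj₁ p < proj₁ q
LexDesc-snd≡ _ (inj₁ lt) = lt
LexDesc-snd≡ refl (inj₂ (_ , lt)) = ⊥-elim (<-irrefl refl lt)

-- Dyadic blocks and levels

_>>_ : ℕ → ℕ → ℕ
x >> zero = x
x >> suc h = (x / 2) >> h

>>-suc : ∀ h x → x >> suc h ≡ (x >> h) / 2
>>-suc zero x = refl
>>-suc (suc h) x = >>-suc h (x / 2)

>>-mono : ∀ h {x y} → x ≤ y → x >> h ≤ y >> h
>>-mono zero x≤y = x≤y
>>-mono (suc h) x≤y = >>-mono h (/-monoˡ-≤ 2 x≤y)

>>-small : ∀ h x → x < 2 ^ h → x >> h ≡ 0
>>-small zero zero _ = refl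
>>-small zero (suc x) (s≤s ())
>>-small (suc h) x x<2^1+h = >>-small h (x / 2) (m<n*o⇒m/o<n (subst (x <_) (*-comm 2 (2 ^ h)) x<2^1+h))

-- x and y lie in the same block [j 2^h, (j + 1) 2^h).
SameBlock : ℕ → ℕ → ℕ → Set
SameBlock h x y = x >> h ≡ y >> h

sameBlock-suc : ∀ h {x y} → SameBlock h x y → SameBlock (suc h) x y
sameBlock-suc h {x} {y} x~y = begin
  x >> suc h    ≡⟨ >>-suc h x ⟩
  (x >> h) / 2  ≡⟨ cong (_/ 2) x~y ⟩
  (y >> h) / 2  ≡⟨ >>-suc h y ⟨
  y >> suc h    ∎
  where open ≡-Reasoning

sameBlock-mono : ∀ {h h′ x y} → h ≤ h′ → SameBlock h x y → SameBlock h′ x y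
sameBlock-mono h≤h′ = go (≤⇒≤′ h≤h′)
  where
  go : ∀ {h h′ x y} → h ≤′ h′ → SameBlock h x y → SameBlock h′ x y
  go ≤′-refl x~y = x~y
  go {h′ = suc h′} (≤′-step h≤h′) x~y = sameBlock-suc h′ (go h≤h′ x~y)

sameBlock-top : ∀ {k x y} → x < 2 ^ k → y < 2 ^ k → SameBlock k x y
sameBlock-top {k} {x} {y} x< y< = trans (>>-small k x x<) (≡.sym (>>-small k y y<))

sameBlock-sandwich : ∀ {h x y z} → x ≤ y → y ≤ z → SameBlock h x z → SameBlock h x y
sameBlock-sandwich {h} x≤y y≤z x~z =
  ≤-antisym (>>-mono h x≤y) (≤-trans (>>-mono h y≤z) (≤-reflexive (≡.sym x~z)))

two-valued : ∀ {i j l} → i < 2 → j < 2 → l < 2 → i ≢ l → j ≢ l → i ≡ j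
two-valued {0} {0} _ _ _ _ _ = refl
two-valued {1} {1} _ _ _ _ _ = refl
two-valued {0} {1} {0} _ _ _ i≢l _ = ⊥-elim (i≢l refl)
two-valued {0} {1} {1} _ _ _ _ j≢l = ⊥-elim (j≢l refl)
two-valued {1} {0} {0} _ _ _ _ j≢l = ⊥-elim (j≢l refl)
two-valued {1} {0} {1} _ _ _ i≢l _ = ⊥-elim (i≢l refl)
two-valued {suc (suc _)} (s≤s (s≤s ())) _ _ _ _
two-valued {_} {suc (suc _)} _ (s≤s (s≤s ())) _ _ _
two-valued {_} {_} {suc (suc _)} _ _ (s≤s (s≤s ())) _ _

%2-/2-injective : ∀ {p q} → p % 2 ≡ q % 2 → p / 2 ≡ q / 2 → p ≡ q
%2-/2-injective {p} {q} %≡ /≡ = begin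
  p                  ≡⟨ m≡m%n+[m/n]*n p 2 ⟩
  p % 2 + p / 2 * 2  ≡⟨ cong₂ (λ r d → r + d * 2) %≡ /≡ ⟩
  q % 2 + q / 2 * 2  ≡⟨ m≡m%n+[m/n]*n q 2 ⟨
  q                  ∎
  where open ≡-Reasoning

halves-pigeonhole : ∀ {p q r} → p / 2 ≡ r / 2 → q / 2 ≡ r / 2 → p ≢ r → q ≢ r → p ≡ q
halves-pigeonhole {p} {q} {r} p~r q~r p≢r q≢r =
  %2-/2-injective (two-valued (m%n<n p 2) (m%n<n q 2) (m%n<n r 2)
                              (λ e → p≢r (%2-/2-injective e p~r)) (λ e → q≢r (%2-/2-injective e q~r)))
                  (trans p~r (≡.sym q~r))

sameBlock-pigeonhole : ∀ {h x y z} → SameBlock (suc h) x z → SameBlock (suc h) y z →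
                       ¬ SameBlock h x z → ¬ SameBlock h y z → SameBlock h x y
sameBlock-pigeonhole {h} x~z y~z = halves-pigeonhole (halves x~z) (halves y~z)
  where
  halves : ∀ {p q} → SameBlock (suc h) p q → (p >> h) / 2 ≡ (q >> h) / 2
  halves {p} {q} p~q = trans (≡.sym (>>-suc h p)) (trans p~q (>>-suc h q))

-- The least h ≤ k with SameBlock h x y (for x, y < 2 ^ k).
level : ℕ → ℕ → ℕ → ℕ
level zero x y = 0
level (suc k) x y with x ≟ y
... | yes _ = 0
... | no _ = suc (level k (x / 2) (y / 2))

level-sameBlock : ∀ k x y → SameBlock k x y → SameBlock (level k x y) x y
level-sameBlock zero x y x~y = x~y
level-sameBlock (suc k) x y x~y with x ≟ y
... | yes x≡y = x≡y
... | no _ = level-sameBlock k (x / 2) (y / 2) x~y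

level-minimal : ∀ k {h} x y → SameBlock h x y → level k x y ≤ h
level-minimal zero x y _ = z≤n
level-minimal (suc k) {zero} x y x≡y with x ≟ y
... | yes _ = z≤n
... | no x≢y = ⊥-elim (x≢y x≡y)
level-minimal (suc k) {suc h} x y x~y with x ≟ y
... | yes _ = z≤n
... | no _ = s≤s (level-minimal k (x / 2) (y / 2) x~y)

level-no-equilateral : ∀ k {x y z} → SameBlock k x y → SameBlock k x z → SameBlock k y z →
                       level k x z ≡ level k x y → level k y z ≡ level k x y → 0 < level k x y → ⊥
level-no-equilateral k {x} {y} {z} x~y x~z y~z xz≡xy yz≡xy 0<xy = go (level k x y) refl 0<xy
  where
  at : ∀ {p q h} → SameBlock k p q → level k p q ≡ suc h → SameBlock (suc h) p q
  at {p} {q} p~q ℓ≡ = subst (λ ℓ → SameBlock ℓ p q) ℓ≡ (level-sameBlock k p q p~q)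

  not-below : ∀ {p q h} → level k p q ≡ suc h → ¬ SameBlock h p q
  not-below {p} {q} {h} ℓ≡ p~q = <-irrefl refl (subst (_≤ h) ℓ≡ (level-minimal k p q p~q))

  go : ∀ ℓ → level k x y ≡ ℓ → 0 < ℓ → ⊥
  go (suc h) xy≡ _ = not-below xy≡
    (sameBlock-pigeonhole {h = h} (at x~z xz≡) (at y~z yz≡) (not-below xz≡) (not-below yz≡))
    where
    xz≡ : level k x z ≡ suc h
    xz≡ = trans xz≡xy xy≡
    yz≡ : level k y z ≡ suc h
    yz≡ = trans yz≡xy xy≡

Between : ℕ → ℕ → ℕ → Set
Between a b y = (a < y × y < b) ⊎ (b < y × y < a)

SameSide : ℕ → ℕ → ℕ → Set
SameSide a b y = (a < b × a < y) ⊎ (b < a × y < a)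

m∸o≤n∸o⇒m≤n : ∀ {m n o} → o ≤ m → o ≤ n → m ∸ o ≤ n ∸ o → m ≤ n
m∸o≤n∸o⇒m≤n {m} {n} {o} o≤m o≤n le = subst (_≤ n) (m∸n+n≡m o≤m) (m≤o∸n⇒m+n≤o (m ∸ o) o≤n le)

sameBlock-sameSide : ∀ {h a b y} → SameBlock h y b → ¬ SameBlock h a b → SameSide a b y
sameBlock-sameSide {h} {a} {b} {y} y~b a≁b with <-cmp a b
... | tri< a<b _ _ = inj₁ (a<b , ≰⇒> λ y≤a →
        a≁b (trans (≡.sym (sameBlock-sandwich {h} y≤a (<⇒≤ a<b) y~b)) y~b))
... | tri≈ _ refl _ = ⊥-elim (a≁b refl)
... | tri> _ _ b<a = inj₂ (b<a , ≰⇒> λ a≤y →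
        a≁b (≡.sym (sameBlock-sandwich {h} (<⇒≤ b<a) a≤y (≡.sym y~b))))

sameSide-closer⇒between : ∀ {a b y} → SameSide a b y → ∣ a - y ∣ ≤ ∣ a - b ∣ → y ≢ b → Between a b y
sameSide-closer⇒between {a} {b} {y} (inj₁ (a<b , a<y)) d y≢b = inj₁ (a<y , ≤∧≢⇒< y≤b y≢b)
  where
  y≤b : y ≤ b
  y≤b = m∸o≤n∸o⇒m≤n (<⇒≤ a<y) (<⇒≤ a<b)
          (subst₂ _≤_ (m≤n⇒∣m-n∣≡n∸m (<⇒≤ a<y)) (m≤n⇒∣m-n∣≡n∸m (<⇒≤ a<b)) d)
sameSide-closer⇒between {a} {b} {y} (inj₂ (b<a , y<a)) d y≢b = inj₂ (≤∧≢⇒< b≤y (y≢b ∘ ≡.sym) , y<a)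
  where
  b≤y : b ≤ y
  b≤y = ∸-cancelʳ-≤ (<⇒≤ b<a)
          (subst₂ _≤_ (m≤n⇒∣n-m∣≡n∸m (<⇒≤ y<a)) (m≤n⇒∣n-m∣≡n∸m (<⇒≤ b<a)) d)

between-unique : ∀ {a b y y′} → Between a b y → Between a b y′ →
                 ∣ a - y ∣ ≤ ∣ a - y′ ∣ → ∣ y - b ∣ ≤ ∣ y′ - b ∣ → y ≡ y′
between-unique (inj₁ (a<y , y<b)) (inj₁ (a<y′ , y′<b)) da db = ≤-antisym
  (m∸o≤n∸o⇒m≤n (<⇒≤ a<y) (<⇒≤ a<y′)
    (subst₂ _≤_ (m≤n⇒∣m-n∣≡n∸m (<⇒≤ a<y)) (m≤n⇒∣m-n∣≡n∸m (<⇒≤ a<y′)) da))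
  (∸-cancelʳ-≤ (<⇒≤ y′<b)
    (subst₂ _≤_ (m≤n⇒∣m-n∣≡n∸m (<⇒≤ y<b)) (m≤n⇒∣m-n∣≡n∸m (<⇒≤ y′<b)) db))
between-unique (inj₂ (b<y , y<a)) (inj₂ (b<y′ , y′<a)) da db = ≤-antisym
  (m∸o≤n∸o⇒m≤n (<⇒≤ b<y) (<⇒≤ b<y′)
    (subst₂ _≤_ (m≤n⇒∣n-m∣≡n∸m (<⇒≤ b<y)) (m≤n⇒∣n-m∣≡n∸m (<⇒≤ b<y′)) db))
  (∸-cancelʳ-≤ (<⇒≤ y′<a)
    (subst₂ _≤_ (m≤n⇒∣n-m∣≡n∸m (<⇒≤ y<a)) (m≤n⇒∣n-m∣≡n∸m (<⇒≤ y′<a)) da))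
between-unique (inj₁ (a<y , y<b)) (inj₂ (b<y′ , y′<a)) _ _ =
  ⊥-elim (<-asym (<-trans a<y y<b) (<-trans b<y′ y′<a))
between-unique (inj₂ (b<y , y<a)) (inj₁ (a<y′ , y′<b)) _ _ =
  ⊥-elim (<-asym (<-trans a<y′ y′<b) (<-trans b<y y<a))

descent-length≤head : ∀ m (f : ℕ → ℕ) → (∀ i → i < m → 0 < f i) →
                      (∀ i → suc i < m → f (suc i) < f i) → m ≤ f 0
descent-length≤head zero f _ _ = z≤n
descent-length≤head (suc zero) f positive _ = positive 0 (s≤s z≤n)
descent-length≤head (suc (suc m)) f positive descending =
  ≤-trans (s≤s (descent-length≤head (suc m) (f ∘ suc) (λ i i<m → positive (suc i) (s≤s i<m))
                                                     (λ i lt → descending (suc i) (s≤s lt))))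
          (descending 0 (s≤s (s≤s z≤n)))

≢⇒≡ᵇ-false : ∀ {m n} → m ≢ n → (m ≡ᵇ n) ≡ false
≢⇒≡ᵇ-false {m} {n} m≢n with m ≡ᵇ n | ≡ᵇ⇒≡ m n
... | false | _ = refl
... | true | sound = ⊥-elim (m≢n (sound tt))

module Dₙ (k : ℕ) where

  vertex : ℕ → Fin (suc (suc k))
  vertex i = i mod suc (suc k)

  toℕ-vertex : ∀ {i} → i ≤ suc k → toℕ (vertex i) ≡ i
  toℕ-vertex i≤1+k = trans (toℕ-fromℕ< _) (m<n⇒m%n≡m (s≤s i≤1+k))

  edge-first : ∀ {i} → 0 < i → i ≤ suc k → Edge (D (suc (suc k))) (vertex 0) (vertex i)
  edge-first {suc i} _ i≤1+k rewrite toℕ-vertex i≤1+k = refl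

  edge-last : ∀ {i} → i ≤ k → Edge (D (suc (suc k))) (vertex i) (vertex (suc k))
  edge-last {zero} _ rewrite toℕ-vertex {suc k} ≤-refl = refl
  edge-last {suc i} i<k
    rewrite toℕ-vertex (m≤n⇒m≤1+n i<k) | toℕ-vertex {suc k} ≤-refl
          | ≢⇒≡ᵇ-false (<⇒≢ i<k) | ≡ᵇ-refl k = refl

  rank-first : ∀ {i} → i ≤ suc k → rankD (suc (suc k)) (vertex 0) (vertex i) ≡ i
  rank-first = toℕ-vertex

  rank-last : ∀ {i} → i ≤ k → rankD (suc (suc k)) (vertex i) (vertex (suc k)) ≡ suc k + i
  rank-last {zero} _ = trans (toℕ-vertex ≤-refl) (≡.sym (+-identityʳ (suc k)))
  rank-last {suc i} i<k rewrite toℕ-vertex (m≤n⇒m≤1+n i<k) | toℕ-vertex {suc k} ≤-refl | ≡ᵇ-refl k = refl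

-- Ordering the edges of a graph coloured with 2 ^ k colours

module ColouredOrdering {k : ℕ} (G : Graph) (c : Fin (V G) → Fin (2 ^ k))
                        (proper : ∀ u v → Edge G u v → c u ≢ c v) where

  N : ℕ
  N = V G

  Vx : Set
  Vx = Fin N

  col : Vx → ℕ
  col u = toℕ (c u)

  edge-colours : ∀ {u v} → Edge G u v → col u ≢ col v
  edge-colours {u} {v} uv = proper u v uv ∘ toℕ-injective

  col-sameBlock : ∀ u v → SameBlock k (col u) (col v)
  col-sameBlock u v = sameBlock-top {k} (toℕ<n (c u)) (toℕ<n (c v))

  edgeLevel : Vx → Vx → ℕ
  edgeLevel u v = level k (col u) (col v)

  edgeLevel-sameBlock : ∀ u v → SameBlock (edgeLevel u v) (col u) (col v)
  edgeLevel-sameBlock u v = level-sameBlock k (col u) (col v) (col-sameBlock u v)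

  edgeLevel-minimal : ∀ {h} u v → SameBlock h (col u) (col v) → edgeLevel u v ≤ h
  edgeLevel-minimal u v = level-minimal k (col u) (col v)

  below-edgeLevel : ∀ {h u v} → h < edgeLevel u v → ¬ SameBlock h (col u) (col v)
  below-edgeLevel {u = u} {v} h<ℓ = <⇒≱ h<ℓ ∘ edgeLevel-minimal u v

  edgeLevel-≤ : ∀ u v → edgeLevel u v ≤ k
  edgeLevel-≤ u v = edgeLevel-minimal u v (col-sameBlock u v)

  edgeLevel-sym : ∀ u v → edgeLevel u v ≡ edgeLevel v u
  edgeLevel-sym u v = ≤-antisym (edgeLevel-minimal u v (≡.sym (edgeLevel-sameBlock v u)))
                                (edgeLevel-minimal v u (≡.sym (edgeLevel-sameBlock u v)))

  edgeLevel-positive : ∀ {u v} → Edge G u v → 0 < edgeLevel u v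
  edgeLevel-positive {u} {v} uv with edgeLevel u v | edgeLevel-sameBlock u v
  ... | zero | u≡v = ⊥-elim (edge-colours uv u≡v)
  ... | suc _ | _ = s≤s z≤n

  distance : Vx → Vx → ℕ
  distance u v = ∣ col u - col v ∣

  -- Indices of the endpoints of smaller and larger colour.  The junk value (0 , 0)
  -- for equal colours (non-edges only) keeps ends, hence the rank, symmetric.
  ends : Vx → Vx → ℕ × ℕ
  ends u v with <-cmp (col u) (col v)
  ... | tri< _ _ _ = toℕ u , toℕ v
  ... | tri≈ _ _ _ = 0 , 0
  ... | tri> _ _ _ = toℕ v , toℕ u

  ends-< : ∀ {u v} → col u < col v → ends u v ≡ (toℕ u , toℕ v)
  ends-< {u} {v} u<v with <-cmp (col u) (col v)
  ... | tri< _ _ _ = refl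
  ... | tri≈ u≮v _ _ = ⊥-elim (u≮v u<v)
  ... | tri> u≮v _ _ = ⊥-elim (u≮v u<v)

  ends-> : ∀ {u v} → col v < col u → ends u v ≡ (toℕ v , toℕ u)
  ends-> {u} {v} v<u with <-cmp (col u) (col v)
  ... | tri< _ _ v≮u = ⊥-elim (v≮u v<u)
  ... | tri≈ _ _ v≮u = ⊥-elim (v≮u v<u)
  ... | tri> _ _ _ = refl

  ends-≈ : ∀ {u v} → col u ≡ col v → ends u v ≡ (0 , 0)
  ends-≈ {u} {v} u≡v with <-cmp (col u) (col v)
  ... | tri< _ u≢v _ = ⊥-elim (u≢v u≡v)
  ... | tri≈ _ _ _ = refl
  ... | tri> _ u≢v _ = ⊥-elim (u≢v u≡v)

  ends-sym : ∀ u v → ends u v ≡ ends v u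
  ends-sym u v with <-cmp (col u) (col v)
  ... | tri< u<v _ _ = ≡.sym (ends-> u<v)
  ... | tri≈ _ u≡v _ = ≡.sym (ends-≈ (≡.sym u≡v))
  ... | tri> _ _ v<u = ≡.sym (ends-< v<u)

  ends-≤ : ∀ u v → proj₁ (ends u v) ≤ N × proj₂ (ends u v) ≤ N
  ends-≤ u v with <-cmp (col u) (col v)
  ... | tri< _ _ _ = <⇒≤ (toℕ<n u) , <⇒≤ (toℕ<n v)
  ... | tri≈ _ _ _ = z≤n , z≤n
  ... | tri> _ _ _ = <⇒≤ (toℕ<n v) , <⇒≤ (toℕ<n u)

  ends-injective : ∀ {u v u′ v′} → Edge G u v → Edge G u′ v′ →
                   proj₁ (ends u v) ≡ proj₁ (ends u′ v′) → proj₂ (ends u v) ≡ proj₂ (ends u′ v′) →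
                   SamePair u v u′ v′
  ends-injective {u} {v} {u′} {v′} uv u′v′ e₁ e₂ with <-cmp (col u) (col v) | <-cmp (col u′) (col v′)
  ... | tri≈ _ u≡v _ | _ = ⊥-elim (edge-colours uv u≡v)
  ... | _ | tri≈ _ u′≡v′ _ = ⊥-elim (edge-colours u′v′ u′≡v′)
  ... | tri< _ _ _ | tri< _ _ _ = inj₁ (toℕ-injective e₁ , toℕ-injective e₂)
  ... | tri< _ _ _ | tri> _ _ _ = inj₂ (toℕ-injective e₁ , toℕ-injective e₂)
  ... | tri> _ _ _ | tri< _ _ _ = inj₂ (toℕ-injective e₂ , toℕ-injective e₁)
  ... | tri> _ _ _ | tri> _ _ _ = inj₁ (toℕ-injective e₂ , toℕ-injective e₁)

  key : Vx → Vx → Vec ℕ 4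
  key u v = k ∸ edgeLevel u v ∷ distance u v ∷ proj₁ (ends u v) ∷ N ∸ proj₂ (ends u v) ∷ []

  radix : ℕ
  radix = suc (k + 2 ^ k + N)

  key-digits : ∀ u v → All (_< radix) (key u v)
  key-digits u v = s≤s (≤-trans (m∸n≤m k (edgeLevel u v)) k≤)
                 ∷ s≤s (≤-trans distance≤ 2^k≤)
                 ∷ s≤s (≤-trans (proj₁ (ends-≤ u v)) N≤)
                 ∷ s≤s (≤-trans (m∸n≤m N (proj₂ (ends u v))) N≤)
                 ∷ []
    where
    k≤ : k ≤ k + 2 ^ k + N
    k≤ = ≤-trans (m≤m+n k (2 ^ k)) (m≤m+n _ N)
    2^k≤ : 2 ^ k ≤ k + 2 ^ k + N
    2^k≤ = ≤-trans (m≤n+m (2 ^ k) k) (m≤m+n _ N)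
    N≤ : N ≤ k + 2 ^ k + N
    N≤ = m≤n+m N _
    distance≤ : distance u v ≤ 2 ^ k
    distance≤ = ≤-trans (∣m-n∣≤m⊔n (col u) (col v)) (⊔-lub (<⇒≤ (toℕ<n (c u))) (<⇒≤ (toℕ<n (c v))))

  edgeRank : Vx → Vx → ℕ
  edgeRank u v = numeral radix (key u v)

  edgeRank-sym : ∀ u v → edgeRank u v ≡ edgeRank v u
  edgeRank-sym u v = cong (numeral radix) (cong₂ _∷_ (cong (k ∸_) (edgeLevel-sym u v))
                   (cong₂ _∷_ (∣-∣-comm (col u) (col v))
                     (cong (λ e → proj₁ e ∷ N ∸ proj₂ e ∷ []) (ends-sym u v))))

  edgeRank-injective : ∀ u v u′ v′ → Edge G u v → Edge G u′ v′ →
                       edgeRank u v ≡ edgeRank u′ v′ → SamePair u v u′ v′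
  edgeRank-injective u v u′ v′ uv u′v′ eq =
    ends-injective uv u′v′ (∷-injectiveˡ tail≡)
      (∸-cancelˡ-≡ (proj₂ (ends-≤ u v)) (proj₂ (ends-≤ u′ v′)) (∷-injectiveˡ (∷-injectiveʳ tail≡)))
    where
    tail≡ : proj₁ (ends u v) ∷ N ∸ proj₂ (ends u v) ∷ []
          ≡ proj₁ (ends u′ v′) ∷ N ∸ proj₂ (ends u′ v′) ∷ []
    tail≡ = ∷-injectiveʳ (∷-injectiveʳ (numeral-injective (key-digits u v) (key-digits u′ v′) eq))

  ordering : EdgeOrdering G
  ordering = record { rank = edgeRank ; rank-sym = edgeRank-sym ; rank-inj = edgeRank-injective }

  edgeRank-<⇒lex : ∀ {u v u′ v′} → edgeRank u v < edgeRank u′ v′ → Lex-< _≡_ _<_ (key u v) (key u′ v′)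
  edgeRank-<⇒lex {u} {v} {u′} {v′} = numeral-<⇒lex (key-digits u v) (key-digits u′ v′)

  edgeRank-<⇒edgeLevel-≥ : ∀ {u v u′ v′} → edgeRank u v < edgeRank u′ v′ →
                           edgeLevel u′ v′ ≤ edgeLevel u v
  edgeRank-<⇒edgeLevel-≥ {u′ = u′} {v′} lt =
    ∸-cancelʳ-≤ (edgeLevel-≤ u′ v′) (lex-head-≤ (edgeRank-<⇒lex lt))

  edgeRank-<⇒distance-≤ : ∀ {u v u′ v′} → edgeRank u v < edgeRank u′ v′ → edgeLevel u v ≡ edgeLevel u′ v′ →
                      distance u v ≤ distance u′ v′
  edgeRank-<⇒distance-≤ lt ℓ≡ = lex-head-≤ (lex-tail (cong (k ∸_) ℓ≡) (edgeRank-<⇒lex lt))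

  edgeRank-<⇒ends : ∀ {u v u′ v′} → edgeRank u v < edgeRank u′ v′ → edgeLevel u v ≡ edgeLevel u′ v′ →
                distance u v ≡ distance u′ v′ → LexDesc (ends u v) (ends u′ v′)
  edgeRank-<⇒ends lt ℓ≡ d≡ = lex-desc (lex-tail d≡ (lex-tail (cong (k ∸_) ℓ≡) (edgeRank-<⇒lex lt)))

  same-colour-flip : ∀ {a b y y′} → col y ≡ col y′ → Between (col a) (col b) (col y) →
                     LexDesc (ends a y) (ends a y′) → LexDesc (ends y b) (ends y′ b) → ⊥
  same-colour-flip {a} {b} {y} {y′} y≡y′ (inj₁ (a<y , y<b)) before-a before-b =
    <-asym (LexDesc-fst≡ refl (subst₂ LexDesc (ends-< a<y) (ends-< a<y′) before-a))
           (LexDesc-snd≡ refl (subst₂ LexDesc (ends-< y<b) (ends-< y′<b) before-b))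
    where
    a<y′ : col a < col y′
    a<y′ = subst (col a <_) y≡y′ a<y
    y′<b : col y′ < col b
    y′<b = subst (_< col b) y≡y′ y<b
  same-colour-flip {a} {b} {y} {y′} y≡y′ (inj₂ (b<y , y<a)) before-a before-b =
    <-asym (LexDesc-snd≡ refl (subst₂ LexDesc (ends-> y<a) (ends-> y′<a) before-a))
           (LexDesc-fst≡ refl (subst₂ LexDesc (ends-> b<y) (ends-> b<y′) before-b))
    where
    y′<a : col y′ < col a
    y′<a = subst (_< col a) y≡y′ y<a
    b<y′ : col b < col y′
    b<y′ = subst (col b <_) y≡y′ b<y

  record Spoke (a b y : Vx) : Set where
    field
      yb-edge : Edge G y b
      ay<ab : edgeRank a y < edgeRank a b
      ab<yb : edgeRank a b < edgeRank y b

  spoke-level-ay : ∀ {a b y} → Spoke a b y → edgeLevel a y ≡ edgeLevel a b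
  spoke-level-ay {a} {b} {y} s = ≤-antisym (edgeLevel-minimal a y a~y) (edgeRank-<⇒edgeLevel-≥ ay<ab)
    where
    open Spoke s
    a~y : SameBlock (edgeLevel a b) (col a) (col y)
    a~y = trans (edgeLevel-sameBlock a b)
                (≡.sym (sameBlock-mono (edgeRank-<⇒edgeLevel-≥ ab<yb) (edgeLevel-sameBlock y b)))

  spoke-level-yb : ∀ {a b y} → Edge G a b → Spoke a b y → edgeLevel y b < edgeLevel a b
  spoke-level-yb {a} {b} {y} ab s with m≤n⇒m<n∨m≡n (edgeRank-<⇒edgeLevel-≥ (Spoke.ab<yb s))
  ... | inj₁ yb<ab = yb<ab
  ... | inj₂ yb≡ab = ⊥-elim
    (level-no-equilateral k (col-sameBlock a y) (col-sameBlock a b) (col-sameBlock y b)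
      (≡.sym ay≡ab) (trans yb≡ab (≡.sym ay≡ab)) (subst (0 <_) (≡.sym ay≡ab) (edgeLevel-positive ab)))
    where
    ay≡ab : edgeLevel a y ≡ edgeLevel a b
    ay≡ab = spoke-level-ay s

  spoke-between : ∀ {a b y} → Edge G a b → Spoke a b y → Between (col a) (col b) (col y)
  spoke-between {a} {b} {y} ab s =
    sameSide-closer⇒between
      (sameBlock-sameSide {edgeLevel y b} (edgeLevel-sameBlock y b) (below-edgeLevel (spoke-level-yb ab s)))
      (edgeRank-<⇒distance-≤ (Spoke.ay<ab s) (spoke-level-ay s))
      (edge-colours (Spoke.yb-edge s))

  spokes-descend : ∀ {a b y y′} → Edge G a b → Spoke a b y → Spoke a b y′ →
                   edgeRank a y < edgeRank a y′ → edgeRank y b < edgeRank y′ b → edgeLevel y′ b < edgeLevel y b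
  spokes-descend {a} {b} {y} {y′} ab s s′ ay<ay′ yb<y′b with m≤n⇒m<n∨m≡n (edgeRank-<⇒edgeLevel-≥ yb<y′b)
  ... | inj₁ y′b<yb = y′b<yb
  ... | inj₂ y′b≡yb = ⊥-elim (same-colour-flip y≡y′ (spoke-between ab s)
                        (edgeRank-<⇒ends ay<ay′ ay≡ay′ (cong (λ z → ∣ col a - z ∣) y≡y′))
                        (edgeRank-<⇒ends yb<y′b (≡.sym y′b≡yb) (cong (λ z → ∣ z - col b ∣) y≡y′)))
    where
    ay≡ay′ : edgeLevel a y ≡ edgeLevel a y′
    ay≡ay′ = trans (spoke-level-ay s) (≡.sym (spoke-level-ay s′))
    y≡y′ : col y ≡ col y′
    y≡y′ = between-unique (spoke-between ab s) (spoke-between ab s′)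
             (edgeRank-<⇒distance-≤ ay<ay′ ay≡ay′) (edgeRank-<⇒distance-≤ yb<y′b (≡.sym y′b≡yb))

  ordering-avoids-D : ¬ Contains (D (suc (suc k))) (rankD (suc (suc k))) G ordering
  ordering-avoids-D (φ , _ , φ-edge , φ-rank) =
    <-irrefl refl (≤-trans (descent-length≤head (suc k) g g-positive g-descending) (edgeLevel-≤ a b))
    where
    open Dₙ k

    u : ℕ → Vx
    u i = φ (vertex i)

    a b : Vx
    a = u 0
    b = u (suc k)

    g : ℕ → ℕ
    g i = edgeLevel (u i) b

    ordered : ∀ {s t s′ t′ p q} → Edge (D (suc (suc k))) s t → Edge (D (suc (suc k))) s′ t′ →
              rankD (suc (suc k)) s t ≡ p → rankD (suc (suc k)) s′ t′ ≡ q → p < q →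
              edgeRank (φ s) (φ t) < edgeRank (φ s′) (φ t′)
    ordered st s′t′ refl refl = φ-rank _ _ _ _ st s′t′

    to-b : ∀ {i} → i ≤ k → Edge G (u i) b
    to-b i≤k = φ-edge _ _ (edge-last i≤k)

    spoke : ∀ {i} → 0 < i → i ≤ k → Spoke a b (u i)
    spoke {i} 0<i i≤k = record
      { yb-edge = to-b i≤k
      ; ay<ab = ordered (edge-first 0<i (m≤n⇒m≤1+n i≤k)) (edge-last z≤n)
                        (rank-first (m≤n⇒m≤1+n i≤k)) (rank-first ≤-refl) (s≤s i≤k)
      ; ab<yb = ordered (edge-last z≤n) (edge-last i≤k) (rank-last z≤n) (rank-last i≤k) (+-monoʳ-< (suc k) 0<i)
      }

    g-positive : ∀ i → i < suc k → 0 < g i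
    g-positive i i<1+k = edgeLevel-positive (to-b (≤-pred i<1+k))

    g-descending : ∀ i → suc i < suc k → g (suc i) < g i
    g-descending zero 1<1+k = spoke-level-yb (to-b z≤n) (spoke (s≤s z≤n) (≤-pred 1<1+k))
    g-descending (suc i) 2+i<1+k = spokes-descend (to-b z≤n) (spoke (s≤s z≤n) i+1≤k) (spoke (s≤s z≤n) i+2≤k)
      (ordered (edge-first (s≤s z≤n) (m≤n⇒m≤1+n i+1≤k)) (edge-first (s≤s z≤n) (m≤n⇒m≤1+n i+2≤k))
               (rank-first (m≤n⇒m≤1+n i+1≤k)) (rank-first (m≤n⇒m≤1+n i+2≤k)) (n<1+n (suc i)))
      (ordered (edge-last i+1≤k) (edge-last i+2≤k) (rank-last i+1≤k) (rank-last i+2≤k)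
               (+-monoʳ-< (suc k) (n<1+n (suc i))))
      where
      i+2≤k : suc (suc i) ≤ k
      i+2≤k = ≤-pred 2+i<1+k
      i+1≤k : suc i ≤ k
      i+1≤k = ≤-trans (n≤1+n (suc i)) i+2≤k

theorem2p14 : (n : ℕ) → 2 ≤ n → OrderChromaticGreaterThan (D n) (rankD n) (2 ^ (n ∸ 2))
theorem2p14 (suc zero) (s≤s ())
theorem2p14 (suc (suc k)) _ G (c , proper) = ordering , ordering-avoids-D
  where open ColouredOrdering {k} G c proper
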